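{- Let $n\ge 7$. For each integer $a$ with $2\le a\le \lfloor (n-1)/3\rfloor$ and $n-a\equiv 1\pmod 2$, the partition $\left(\tfrac12(n-a+1),\ a+1,\ 1\times \tfrac12(n-a-3)\right)$ of $n$ corresponds to the eigenvalue $\binom{a}{2}$ of $\mathrm{Cay}(S_n,T_n)$, i.e. $\rho_\lambda=\binom a2$ for this partition $\lambda$.
   Context: $\mathrm{Cay}(S_n,T_n)$ is the Cayley graph on the symmetric group $S_n$ generated by the set $T_n$ of all transpositions ($f\sim g$ iff $fg^{ -1}\in T_n$). For a partition $\lambda=(\lambda_1,\dots,\lambda_k)$ of $n$ (parts listed in the order written), put $\rho_\lambda=\sum_{i=1}^k \lambda_i(\lambda_i-2i+1)/2$; the eigenvalues of $\mathrm{Cay}(S_n,T_n)$ are exactly the numbers $\rho_\lambda$ as $\lambda$ ranges over partitions of $n$, and $\lambda$ is said to correspond to the eigenvalue $\rho_\lambda$. The notation $(\mu_1\times t_1,\dots,\mu_r\times t_r)$ denotes the sequence in which $\mu_i$ is repeated $t_i$ times; an entry $\mu$ without "$\times t$" is a single part, and $\mu\times 0$ contributes no parts. -}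

module Defs where

open import Data.Nat using (ℕ; zero; suc; _+_; _*_; _∸_; _≥_; _≤_)
import Data.Nat as ℕ
open import Data.Nat.ListAction using (sum)
open import Data.List using (List; []; _∷_; replicate)
open import Data.List.Relation.Unary.All using (All)
open import Data.List.Relation.Unary.Linked using (Linked)
open import Data.Product using (_×_)
open import Relation.Binary.PropositionalEquality using (_≡_)
import Data.Integer as ℤ
open import Data.Rational using (ℚ)
import Data.Rational as ℚ

IsPartitionOf : ℕ → List ℕ → Set
IsPartitionOf n ls = All (λ x → 1 ≤ x) ls × Linked _≥_ ls × sum ls ≡ n

ρ-term : ℕ → ℕ → ℚ
ρ-term i l = (ℤ.+ l ℤ.* ((ℤ.+ l ℤ.- ℤ.+ (2 * i)) ℤ.+ ℤ.+ 1)) ℚ./ 2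

ρ-from : ℕ → List ℕ → ℚ
ρ-from i [] = ℚ.0ℚ
ρ-from i (l ∷ ls) = ρ-term i l ℚ.+ ρ-from (suc i) ls

ρ : List ℕ → ℚ
ρ ls = ρ-from 1 ls

-- the partition ( (n-a+1)/2 , a+1 , 1 × (n-a-3)/2 )   (ℕ floor division,
-- exact under the hypothesis n - a odd and n - a ≥ 3)
lam : ℕ → ℕ → List ℕ
lam n a = ((n ∸ a + 1) ℕ./ 2) ∷ (a + 1) ∷ replicate ((n ∸ a ∸ 3) ℕ./ 2) 1

{-# OPTIONS --safe #-}
module Submission where

-- Write n − a = 3 + 2k; the partition is then (k + 2, a + 1, 1 × k), and the
-- bound a ≤ ⌊(n − 1)/3⌋ is exactly what makes a + 1 ≤ k + 2.  Computing 2ρ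
-- over ℤ, the tail of ones contributes −k(k + 3), which cancels the k-dependence
-- of the first part (k + 2)(k + 1), leaving a(a − 1) = 2·C(a, 2).

open import Defs
open import Data.Nat using (ℕ; zero; suc)
import Data.Nat as ℕ
open import Data.List using (List; []; _∷_; replicate)
open import Relation.Binary.PropositionalEquality
  using (_≡_; refl; sym; trans; cong; cong₂; subst; subst₂; module ≡-Reasoning)
import Data.Integer as ℤ
import Data.Rational as ℚ

[_,_,1×_] : ℕ → ℕ → ℕ → List ℕ
[ x , y ,1× k ] = x ∷ y ∷ replicate k 1

module _ where
  open import Data.Nat using (_+_; _*_; _≤_; _≥_; _∸_; _/_; _%_; s≤s)
  open import Data.Nat.Properties
  open import Data.Nat.DivMod using (m≡m%n+[m/n]*n; m/n*n≤m; m*n/n≡m)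
  open import Data.Nat.Combinatorics using (_C_; nCk+nC[k+1]≡[n+1]C[k+1]; nC1≡n)
  open import Data.Nat.ListAction using (sum)
  open import Data.Nat.Tactic.RingSolver using (solve-∀)
  open import Data.List.Relation.Unary.All using (_∷_)
  open import Data.List.Relation.Unary.All.Properties using (replicate⁺)
  open import Data.List.Relation.Unary.Linked using (Linked; [-]; _∷_)
  open import Data.Product using (_×_; _,_; ∃-syntax)
  open import Relation.Nullary using (contradiction)
  open ≡-Reasoning

  [1+n]C2*2≡[1+n]*n : ∀ n → (suc n C 2) * 2 ≡ suc n * n
  [1+n]C2*2≡[1+n]*n zero = refl
  [1+n]C2*2≡[1+n]*n (suc n) = begin
    (suc (suc n) C 2) * 2               ≡⟨ cong (_* 2) (nCk+nC[k+1]≡[n+1]C[k+1] (suc n) 1) ⟨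
    (suc n C 1 + suc n C 2) * 2         ≡⟨ *-distribʳ-+ 2 (suc n C 1) (suc n C 2) ⟩
    (suc n C 1) * 2 + (suc n C 2) * 2   ≡⟨ cong₂ _+_ (cong (_* 2) (nC1≡n (suc n)))
                                                        ([1+n]C2*2≡[1+n]*n n) ⟩
    suc n * 2 + suc n * n               ≡⟨ *-distribˡ-+ (suc n) 2 n ⟨
    suc n * suc (suc n)                 ≡⟨ *-comm (suc n) (suc (suc n)) ⟩
    suc (suc n) * suc n                 ∎

  sum-replicate-1 : ∀ k → sum (replicate k 1) ≡ k
  sum-replicate-1 zero = refl
  sum-replicate-1 (suc k) = cong suc (sum-replicate-1 k)

  replicate-linked-≥ : ∀ {x y} k → y ≤ x → Linked _≥_ (x ∷ replicate k y)
  replicate-linked-≥ zero y≤x = [-]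
  replicate-linked-≥ (suc k) y≤x = y≤x ∷ replicate-linked-≥ k ≤-refl

  [x,y,1×k]-isPartition : ∀ {x y} k → 1 ≤ y → y ≤ x →
                          IsPartitionOf (x + (y + k)) [ x , y ,1× k ]
  [x,y,1×k]-isPartition {x} {y} k 1≤y y≤x =
      ≤-trans 1≤y y≤x ∷ 1≤y ∷ replicate⁺ k ≤-refl
    , y≤x ∷ replicate-linked-≥ k 1≤y
    , cong (λ s → x + (y + s)) (sum-replicate-1 k)

  [2+k,a+1,1×k]-isPartition : ∀ a k → a ≤ suc k →
                              IsPartitionOf (a + (3 + k * 2)) [ 2 + k , a + 1 ,1× k ]
  [2+k,a+1,1×k]-isPartition a k a≤1+k =
    subst (λ m → IsPartitionOf m [ 2 + k , a + 1 ,1× k ]) (sizes a k)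
      ([x,y,1×k]-isPartition k (m≤n+m 1 a) (subst (_≤ 2 + k) (+-comm 1 a) (s≤s a≤1+k)))
    where
    sizes : ∀ a k → 2 + k + (a + 1 + k) ≡ a + (3 + k * 2)
    sizes = solve-∀

  lam-[a+3+2k]≡[2+k,a+1,1×k] : ∀ a k → lam (a + (3 + k * 2)) a ≡ [ 2 + k , a + 1 ,1× k ]
  lam-[a+3+2k]≡[2+k,a+1,1×k] a k = begin
      lam (a + (3 + k * 2)) a
    ≡⟨ cong (λ d → [ (d + 1) / 2 , a + 1 ,1× (d ∸ 3) / 2 ]) (m+n∸m≡n a (3 + k * 2)) ⟩
      [ (3 + k * 2 + 1) / 2 , a + 1 ,1× (k * 2) / 2 ]
    ≡⟨ cong₂ [_, a + 1 ,1×_] (trans (cong (_/ 2) (+-comm (3 + k * 2) 1)) (m*n/n≡m (2 + k) 2))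
                             (m*n/n≡m k 2) ⟩
      [ 2 + k , a + 1 ,1× k ]
    ∎

  odd-gap-decomposition : ∀ {n a} → 1 ≤ a → a ≤ (n ∸ 1) / 3 → (n ∸ a) % 2 ≡ 1 →
    ∃[ k ] a ≤ suc k × n ≡ a + (3 + k * 2)
  odd-gap-decomposition {n} {a} 1≤a a≤⌊n∸1⌋/3 odd = split q a≤q n≡a+[1+2q]
    where
    q : ℕ
    q = (n ∸ a) / 2
    n∸a≡1+2q : n ∸ a ≡ suc (q * 2)
    n∸a≡1+2q = trans (m≡m%n+[m/n]*n (n ∸ a) 2) (cong (_+ q * 2) odd)
    a≤n : a ≤ n
    a≤n = <⇒≤ (m∸n≢0⇒n<m (λ n∸a≡0 → 0≢1+n (trans (sym n∸a≡0) n∸a≡1+2q)))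
    n≡a+[1+2q] : n ≡ a + suc (q * 2)
    n≡a+[1+2q] = trans (sym (m+[n∸m]≡n a≤n)) (cong (a +_) n∸a≡1+2q)
    a*3≤n∸1 : a * 3 ≤ n ∸ 1
    a*3≤n∸1 = ≤-trans (*-monoˡ-≤ 3 a≤⌊n∸1⌋/3) (m/n*n≤m (n ∸ 1) 3)
    n∸1≡a+2q : n ∸ 1 ≡ a + q * 2
    n∸1≡a+2q = cong (_∸ 1) (trans n≡a+[1+2q] (+-suc a (q * 2)))
    a≤q : a ≤ q
    a≤q = *-cancelʳ-≤ a q 2 (+-cancelˡ-≤ a _ _ (subst₂ _≤_ (*-suc a 2) n∸1≡a+2q a*3≤n∸1))
    split : ∀ q → a ≤ q → n ≡ a + suc (q * 2) → ∃[ k ] a ≤ suc k × n ≡ a + (3 + k * 2)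
    split zero a≤0 _ = contradiction (≤-trans 1≤a a≤0) λ ()
    split (suc k) a≤1+k n≡a+3+2k = k , a≤1+k , n≡a+3+2k

module _ where
  open import Data.Integer using (ℤ; +_; _+_; _-_; _*_)
  open import Data.Integer.Properties using (pos-*; *-identityʳ)
  open import Data.Integer.Tactic.RingSolver using (solve-∀)
  open import Data.Nat.Combinatorics using (_C_)
  open import Data.Rational using (_/_) renaming (_+_ to _+ℚ_)
  open import Data.Rational.Properties
    using (toℚᵘ-injective; toℚᵘ-homo-+; toℚᵘ-fromℚᵘ; fromℚᵘ-cong)
  open import Data.Rational.Unnormalised as ℚᵘ using (mkℚᵘ; *≡*)
  open import Data.Rational.Unnormalised.Properties using (+-cong; module ≃-Reasoning)

  x/2+y/2≡[x+y]/2 : ∀ x y → x / 2 +ℚ y / 2 ≡ (x + y) / 2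
  x/2+y/2≡[x+y]/2 x y = toℚᵘ-injective (begin
      ℚ.toℚᵘ (x / 2 +ℚ y / 2)              ≈⟨ toℚᵘ-homo-+ (x / 2) (y / 2) ⟩
      ℚ.toℚᵘ (x / 2) ℚᵘ.+ ℚ.toℚᵘ (y / 2)  ≈⟨ +-cong (toℚᵘ-fromℚᵘ (mkℚᵘ x 1))
                                                      (toℚᵘ-fromℚᵘ (mkℚᵘ y 1)) ⟩
      mkℚᵘ x 1 ℚᵘ.+ mkℚᵘ y 1               ≈⟨ *≡* (common-denominator x y) ⟩
      mkℚᵘ (x + y) 1                        ≈⟨ toℚᵘ-fromℚᵘ (mkℚᵘ (x + y) 1) ⟨
      ℚ.toℚᵘ ((x + y) / 2)                  ∎)
    where
    open ≃-Reasoning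
    common-denominator : ∀ x y → (x * + 2 + y * + 2) * + 2 ≡ (x + y) * + 4
    common-denominator = solve-∀

  /-cross : ∀ p q {m n} → p * + suc n ≡ q * + suc m → p / suc m ≡ q / suc n
  /-cross p q {m} {n} eq = fromℚᵘ-cong {mkℚᵘ p m} {mkℚᵘ q n} (*≡* eq)

  twiceρ-term : ℕ → ℕ → ℤ
  twiceρ-term i l = + l * ((+ l - + (2 ℕ.* i)) + + 1)

  twiceρ-from : ℕ → List ℕ → ℤ
  twiceρ-from i [] = + 0
  twiceρ-from i (l ∷ ls) = twiceρ-term i l + twiceρ-from (suc i) ls

  ρ-from≡twiceρ-from/2 : ∀ i ls → ρ-from i ls ≡ twiceρ-from i ls / 2
  ρ-from≡twiceρ-from/2 i [] = refl
  ρ-from≡twiceρ-from/2 i (l ∷ ls) =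
    trans (cong (ρ-term i l +ℚ_) (ρ-from≡twiceρ-from/2 (suc i) ls))
          (x/2+y/2≡[x+y]/2 (twiceρ-term i l) (twiceρ-from (suc i) ls))

  twiceρ-from-ones : ∀ i k → twiceρ-from i (replicate k 1) ≡ + k * (+ 3 - + 2 * + i - + k)
  twiceρ-from-ones i zero = refl
  twiceρ-from-ones i (suc k) = begin
      twiceρ-term i 1 + twiceρ-from (suc i) (replicate k 1)
    ≡⟨ cong₂ (λ t s → + 1 * ((+ 1 - t) + + 1) + s) (pos-* 2 i) (twiceρ-from-ones (suc i) k) ⟩
      + 1 * ((+ 1 - + 2 * + i) + + 1) + + k * (+ 3 - + 2 * (+ 1 + + i) - + k)
    ≡⟨ shift (+ i) (+ k) ⟩
      (+ 1 + + k) * (+ 3 - + 2 * + i - (+ 1 + + k))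
    ∎
    where
    open ≡-Reasoning
    shift : ∀ i k → + 1 * ((+ 1 - + 2 * i) + + 1) + k * (+ 3 - + 2 * (+ 1 + i) - k)
                  ≡ (+ 1 + k) * (+ 3 - + 2 * i - (+ 1 + k))
    shift = solve-∀

  twiceρ-[x,y,1×k] : ∀ x y k →
    twiceρ-from 1 [ x , y ,1× k ] ≡ + x * (+ x - + 1) + + y * (+ y - + 3) - + k * (+ k + + 3)
  twiceρ-[x,y,1×k] x y k = begin
      twiceρ-term 1 x + (twiceρ-term 2 y + twiceρ-from 3 (replicate k 1))
    ≡⟨ cong (λ s → twiceρ-term 1 x + (twiceρ-term 2 y + s)) (twiceρ-from-ones 3 k) ⟩
      twiceρ-term 1 x + (twiceρ-term 2 y + + k * (+ 3 - + 2 * + 3 - + k))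
    ≡⟨ collect (+ x) (+ y) (+ k) ⟩
      + x * (+ x - + 1) + + y * (+ y - + 3) - + k * (+ k + + 3)
    ∎
    where
    open ≡-Reasoning
    collect : ∀ x y k → x * ((x - + 2) + + 1) + (y * ((y - + 4) + + 1) + k * (+ 3 - + 2 * + 3 - k))
                      ≡ x * (x - + 1) + y * (y - + 3) - k * (k + + 3)
    collect = solve-∀

  twiceρ-[2+k,a+1,1×k] : ∀ a k → twiceρ-from 1 [ 2 ℕ.+ k , a ℕ.+ 1 ,1× k ] ≡ + a * (+ a - + 1)
  twiceρ-[2+k,a+1,1×k] a k = trans (twiceρ-[x,y,1×k] (2 ℕ.+ k) (a ℕ.+ 1) k) (cancel (+ a) (+ k))
    where
    cancel : ∀ a k → (+ 2 + k) * ((+ 2 + k) - + 1) + (a + + 1) * ((a + + 1) - + 3) - k * (k + + 3)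
                   ≡ a * (a - + 1)
    cancel = solve-∀

  [nC2]*2≡n*[n-1] : ∀ n → + (n C 2) * + 2 ≡ + n * (+ n - + 1)
  [nC2]*2≡n*[n-1] zero = refl
  [nC2]*2≡n*[n-1] (suc n) = begin
    + (suc n C 2) * + 2        ≡⟨ pos-* (suc n C 2) 2 ⟨
    + ((suc n C 2) ℕ.* 2)      ≡⟨ cong +_ ([1+n]C2*2≡[1+n]*n n) ⟩
    + (suc n ℕ.* n)            ≡⟨ pos-* (suc n) n ⟩
    + suc n * + n              ≡⟨ cong (+ suc n *_) (pred-suc (+ n)) ⟩
    + suc n * (+ suc n - + 1)  ∎
    where
    open ≡-Reasoning
    pred-suc : ∀ n → n ≡ (+ 1 + n) - + 1
    pred-suc = solve-∀

  ρ-[2+k,a+1,1×k] : ∀ a k → ρ [ 2 ℕ.+ k , a ℕ.+ 1 ,1× k ] ≡ + (a C 2) / 1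
  ρ-[2+k,a+1,1×k] a k =
    trans (ρ-from≡twiceρ-from/2 1 λ′) (/-cross (twiceρ-from 1 λ′) (+ (a C 2)) twiceρ≡2[aC2])
    where
    λ′ : List ℕ
    λ′ = [ 2 ℕ.+ k , a ℕ.+ 1 ,1× k ]
    twiceρ≡2[aC2] : twiceρ-from 1 λ′ * + 1 ≡ + (a C 2) * + 2
    twiceρ≡2[aC2] =
      trans (*-identityʳ _) (trans (twiceρ-[2+k,a+1,1×k] a k) (sym ([nC2]*2≡n*[n-1] a)))

open import Data.Nat using (_≤_; _∸_; _/_; _%_)
open import Data.Nat.Properties using (<⇒≤)
open import Data.Nat.Combinatorics using (_C_)
open import Data.Product using (_×_; _,_)

lemma3p1 : (n a : ℕ) → 7 ≤ n → 2 ≤ a → a ≤ (n ∸ 1) / 3 → (n ∸ a) % 2 ≡ 1 →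
    IsPartitionOf n (lam n a) × ρ (lam n a) ≡ (ℤ.+ (a C 2)) ℚ./ 1
lemma3p1 n a _ 2≤a a≤⌊n∸1⌋/3 odd with odd-gap-decomposition (<⇒≤ 2≤a) a≤⌊n∸1⌋/3 odd
... | k , a≤1+k , refl =
  subst (λ l → IsPartitionOf n l × ρ l ≡ (ℤ.+ (a C 2)) ℚ./ 1)
        (sym (lam-[a+3+2k]≡[2+k,a+1,1×k] a k))
    ([2+k,a+1,1×k]-isPartition a k a≤1+k , ρ-[2+k,a+1,1×k] a k)
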